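{- Let $X$ and $Y$ be finite nonempty sets and let $F: X \to 2^Y$ be a set-valued mapping. If $F$ satisfies the Hall condition, then $F$ admits a Hall partition.
   Context: A set-valued mapping $F: X \to 2^Y$ assigns to each $x \in X$ a (possibly empty) subset $F(x) \subset Y$. For $W \subset X$ put $F(W) = \bigcup_{x \in W} F(x)$ (empty union is empty); $\sharp$ denotes cardinality. $F$ satisfies the Hall condition if $\sharp F(W) \ge \sharp W$ for every $W \subset X$. For $W \subset X$, $Z \subset Y$, the complement mapping $F_{W,Z}: X \setminus W \to 2^{Y \setminus Z}$ is $F_{W,Z}(x) = F(x) \setminus Z$; write $F_W = F_{W,F(W)}$, so $F_W(x) = F(x)\setminus F(W)$ for $x \in X \setminus W$. These notions apply to any set-valued mapping $G$ defined on a finite set. A subset $W$ of the domain of $G$ is a critical set of $G$ if $W \neq \emptyset$ and $\sharp G(W) = \sharp W$. It is a non-reducible set of $G$ if $W \ne \emptyset$ and no proper subset $W' \subsetneq W$ is a critical set of $G$. A tuple $(W_1, \ldots, W_m)$, $m \ge 1$, is a Hall partition of $F$ if $W_1, \ldots, W_m$ are nonempty pairwise disjoint sets with union $X$, and, writing $G_i = F_{W_1 \cup \cdots \cup W_{i-1}}$ (so $G_1 = F$, and $G_i$ is defined on $X \setminus (W_1\cup\cdots\cup W_{i-1})$): (i) $G_i(x) \neq \emptyset$ for all $x \in W_i$, $i = 1,\ldots,m$; (ii) $W_i$ is a non-reducible set of $G_i$ for $i=1,\ldots,m$; (iii) $W_i$ is a critical set of $G_i$ for $i = 1, \ldots, m-1$.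 -}

module Defs where

open import Data.Nat using (ℕ; _≤_)
open import Data.Fin using (Fin)
open import Data.Fin.Subset
open import Data.Fin.Subset.Properties using (_∈?_)
open import Data.List using (List; []; _∷_; filter; allFin)
import Data.List as List
open import Data.List.Relation.Unary.All using (All)
open import Data.List.Relation.Unary.AllPairs using (AllPairs)
open import Data.Product using (_×_)
open import Relation.Binary.PropositionalEquality using (_≡_; _≢_)
open import Relation.Nullary using (¬_)
import Data.Empty as E

-- A set-valued mapping X → 2^Y with X = Fin n, Y = Fin k.
-- A mapping defined on a subset D ⊆ Fin n is represented by a total
-- function Fin n → Subset k together with the domain D (see below).
SVMap : ℕ → ℕ → Set
SVMap n k = Fin n → Subset k

img : ∀ {n k} → SVMap n k → Subset n → Subset k
img {n} F W = ⋃ (List.map F (filter (_∈? W) (allFin n)))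

HallCondition : ∀ {n k} → SVMap n k → Set
HallCondition {n} F = ∀ (W : Subset n) → ∣ W ∣ ≤ ∣ img F W ∣

compl : ∀ {n k} → SVMap n k → Subset k → SVMap n k
compl F Z x = F x ─ Z

-- F_W = F_{W, F(W)}, domain X \ W
complW : ∀ {n k} → SVMap n k → Subset n → SVMap n k
complW F W = compl F (img F W)

Critical : ∀ {n k} → SVMap n k → Subset n → Subset n → Set
Critical G D W = W ⊆ D × Nonempty W × ∣ img G W ∣ ≡ ∣ W ∣

NonReducible : ∀ {n k} → SVMap n k → Subset n → Subset n → Set
NonReducible {n} G D W =
  W ⊆ D × Nonempty W × (∀ (W' : Subset n) → W' ⊂ W → ¬ Critical G D W')

Disjoint : ∀ {n} → Subset n → Subset n → Set
Disjoint p q = Empty (p ∩ q)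

-- Conditions (i)-(iii) on the blocks W_i, W_{i+1}, ..., W_m, where U is
-- the union W_1 ∪ ... ∪ W_{i-1} of the previous blocks, so that
-- G_i = F_U with domain X \ U.
HallSteps : ∀ {n k} → SVMap n k → Subset n → List (Subset n) → Set
HallSteps F U [] = E.⊥
HallSteps F U (W ∷ []) =
  (∀ {x} → x ∈ W → Nonempty (complW F U x))
  × NonReducible (complW F U) (∁ U) W
HallSteps F U (W ∷ W' ∷ Ws) =
  (∀ {x} → x ∈ W → Nonempty (complW F U x))
  × NonReducible (complW F U) (∁ U) W
  × Critical (complW F U) (∁ U) W
  × HallSteps F (U ∪ W) (W' ∷ Ws)

HallPartition : ∀ {n k} → SVMap n k → List (Subset n) → Set
HallPartition {n} F Ws =
  Ws ≢ []
  × All Nonempty Ws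
  × AllPairs Disjoint Ws
  × ⋃ Ws ≡ ⊤
  × HallSteps F ⊥ Ws

{-# OPTIONS --safe #-}
-- Blocks are peeled off greedily. If ♯F(U) = ♯U, then ♯F(U ∪ W) = ♯F(U) + ♯F_U(W)
-- for W ⊆ X \ U, so the Hall condition for F passes to F_U on X \ U (and, applied to
-- singletons, makes every F_U(x) nonempty). If F_U has a critical set, a ⊂-minimal one
-- W is critical and non-reducible, and ♯F(U ∪ W) = ♯(U ∪ W), so the construction
-- continues from U ∪ W; otherwise X \ U itself is the last, non-reducible block.
module Submission where

open import Defs
open import Data.Nat using (ℕ; suc; _<_; _≤_; _+_)
import Data.Nat.Properties as ℕ
open import Data.Fin using (Fin)
import Data.Fin as Fin
open import Data.Fin.Subset
open import Data.Fin.Subset.Properties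
open import Data.Fin.Subset.Induction using (Acc; acc; ⊂-wellFounded; ⊃-wellFounded)
open import Data.Bool using (true; false)
open import Data.Vec using ([]; _∷_; here; there)
open import Data.List using (List; []; _∷_)
import Data.List as List
import Data.List.Membership.Propositional as List
open import Data.List.Membership.Propositional.Properties using (∈-allFin; ∈-map⁺; ∈-map⁻; ∈-filter⁺; ∈-filter⁻)
import Data.List.Relation.Unary.Any as Any
open import Data.List.Relation.Unary.All as All using (All; []; _∷_)
open import Data.List.Relation.Unary.AllPairs using (AllPairs; []; _∷_)
open import Data.Product using (Σ; ∃; _×_; _,_; proj₁; proj₂)
open import Data.Sum using (inj₁; inj₂; [_,_]′)
open import Level using (Level)
open import Relation.Binary.PropositionalEquality
open import Relation.Nullary using (¬_; Dec; yes; no)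
open import Relation.Nullary.Decidable using (_×-dec_)
open import Relation.Unary using (Pred; Decidable)
import Data.Empty as E
open import Function using (_∘′_)

private
  variable
    n k : ℕ
    x : Fin n
    p q : Subset n

x∈p─q⇒x∉q : x ∈ p ─ q → x ∉ q
x∈p─q⇒x∉q {p = true ∷ p} {false ∷ q} here = λ ()
x∈p─q⇒x∉q {p = _ ∷ p} {_ ∷ q} (there x∈) (there x∈q) = x∈p─q⇒x∉q x∈ x∈q

∣p∪q∣≡∣p∣+∣q─p∣ : ∀ (p q : Subset n) → ∣ p ∪ q ∣ ≡ ∣ p ∣ + ∣ q ─ p ∣
∣p∪q∣≡∣p∣+∣q─p∣ []          []          = refl
∣p∪q∣≡∣p∣+∣q─p∣ (true ∷ p)  (true ∷ q)  = cong suc (∣p∪q∣≡∣p∣+∣q─p∣ p q)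
∣p∪q∣≡∣p∣+∣q─p∣ (true ∷ p)  (false ∷ q) = cong suc (∣p∪q∣≡∣p∣+∣q─p∣ p q)
∣p∪q∣≡∣p∣+∣q─p∣ (false ∷ p) (true ∷ q)  =
  trans (cong suc (∣p∪q∣≡∣p∣+∣q─p∣ p q)) (sym (ℕ.+-suc ∣ p ∣ _))
∣p∪q∣≡∣p∣+∣q─p∣ (false ∷ p) (false ∷ q) = ∣p∪q∣≡∣p∣+∣q─p∣ p q

q⊆∁p⇒Disjoint : q ⊆ ∁ p → Disjoint p q
q⊆∁p⇒Disjoint q⊆∁p (_ , x∈p∩q) =
  let (x∈p , x∈q) = x∈p∩q⁻ _ _ x∈p∩q in x∈∁p⇒x∉p (q⊆∁p x∈q) x∈p

r⊆∁p∪q⇒r⊆∁p : ∀ {r : Subset n} → r ⊆ ∁ (p ∪ q) → r ⊆ ∁ p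
r⊆∁p∪q⇒r⊆∁p {q = q} r⊆ = ⊆-trans r⊆ (p⊆q⇒∁p⊇∁q (p⊆p∪q q))

r⊆∁p∪q⇒r⊆∁q : ∀ {r : Subset n} → r ⊆ ∁ (p ∪ q) → r ⊆ ∁ q
r⊆∁p∪q⇒r⊆∁q {p = p} r⊆ = ⊆-trans r⊆ (p⊆q⇒∁p⊇∁q (q⊆p∪q p _))

p⊂p∪q : q ⊆ ∁ p → Nonempty q → p ⊂ p ∪ q
p⊂p∪q {q = q} q⊆∁p (x , x∈q) = p⊆p∪q q , x , x∈p∪q⁺ (inj₂ x∈q) , x∈∁p⇒x∉p (q⊆∁p x∈q)

Disjoint⇒q─p≡q : Disjoint p q → q ─ p ≡ q
Disjoint⇒q─p≡q {q = q} p∩q≡∅ = ⊆-antisym (p─q⊆p q _)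
  (λ x∈q → x∈p∧x∉q⇒x∈p─q x∈q (λ x∈p → p∩q≡∅ (_ , x∈p∩q⁺ (x∈p , x∈q))))

Disjoint⇒∣p∪q∣≡∣p∣+∣q∣ : Disjoint p q → ∣ p ∪ q ∣ ≡ ∣ p ∣ + ∣ q ∣
Disjoint⇒∣p∪q∣≡∣p∣+∣q∣ {p = p} {q} p∩q≡∅ =
  trans (∣p∪q∣≡∣p∣+∣q─p∣ p q) (cong (λ r → ∣ p ∣ + ∣ r ∣) (Disjoint⇒q─p≡q p∩q≡∅))

∣p∣>0⇒Nonempty : ∀ {n} {p : Subset n} → 0 < ∣ p ∣ → Nonempty p
∣p∣>0⇒Nonempty {n} {p} 0<∣p∣ with nonempty? p
... | yes ne = ne
... | no p≡∅ = E.⊥-elim (ℕ.<-irrefl (sym (trans (cong ∣_∣ (Empty-unique p≡∅)) (∣⊥∣≡0 n))) 0<∣p∣)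

Empty∁⇒≡⊤ : Empty (∁ p) → p ≡ ⊤
Empty∁⇒≡⊤ ∁p≡∅ = ⊆-antisym ⊆⊤ (λ _ → x∉∁p⇒x∈p (λ x∈∁p → ∁p≡∅ (_ , x∈∁p)))

x∈p⇒⁅x⁆⊆p : x ∈ p → ⁅ x ⁆ ⊆ p
x∈p⇒⁅x⁆⊆p {x = x} x∈p y∈⁅x⁆ = subst (_∈ _) (sym (x∈⁅y⁆⇒x≡y x y∈⁅x⁆)) x∈p

∈⋃⁻ : ∀ (ps : List (Subset n)) → x ∈ ⋃ ps → ∃ λ p → p List.∈ ps × x ∈ p
∈⋃⁻ []       x∈ = E.⊥-elim (∉⊥ x∈)
∈⋃⁻ (p ∷ ps) x∈ with x∈p∪q⁻ p (⋃ ps) x∈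
... | inj₁ x∈p = p , Any.here refl , x∈p
... | inj₂ x∈⋃ = let (q , q∈ , x∈q) = ∈⋃⁻ ps x∈⋃ in q , Any.there q∈ , x∈q

∈⋃⁺ : ∀ {ps : List (Subset n)} → p List.∈ ps → x ∈ p → x ∈ ⋃ ps
∈⋃⁺ (Any.here refl) x∈p = x∈p∪q⁺ (inj₁ x∈p)
∈⋃⁺ (Any.there p∈) x∈p = x∈p∪q⁺ (inj₂ (∈⋃⁺ p∈ x∈p))

⊂-minimal : ∀ {ℓ : Level} {P : Pred (Subset n) ℓ} → Decidable P →
            ∀ {p} → Acc _⊂_ p → P p → ∃ λ q → P q × (∀ r → r ⊂ q → ¬ P r)
⊂-minimal P? {p} (acc rs) Pp with anySubset? (λ q → (q ⊂? p) ×-dec P? q)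
... | no ∄q        = p , Pp , λ q q⊂p Pq → ∄q (q , q⊂p , Pq)
... | yes (q , q⊂p , Pq) = ⊂-minimal P? (rs q⊂p) Pq

module _ (F : SVMap n k) where

  ∈-img⁻ : ∀ {W y} → y ∈ img F W → ∃ λ x → x ∈ W × y ∈ F x
  ∈-img⁻ {W} y∈ with ∈⋃⁻ (List.map F (List.filter (_∈? W) (List.allFin n))) y∈
  ... | _ , p∈ , y∈p with ∈-map⁻ F p∈
  ... | x , x∈ , refl = x , proj₂ (∈-filter⁻ (_∈? W) {xs = List.allFin n} x∈) , y∈p

  ∈-img⁺ : ∀ {W y} → x ∈ W → y ∈ F x → y ∈ img F W
  ∈-img⁺ {x = x} {W} x∈W = ∈⋃⁺ (∈-map⁺ F (∈-filter⁺ (_∈? W) (∈-allFin x) x∈W))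

  ∈-img⁅x⁆⁻ : ∀ {y} → y ∈ img F ⁅ x ⁆ → y ∈ F x
  ∈-img⁅x⁆⁻ {x = x} y∈ with ∈-img⁻ y∈
  ... | x' , x'∈⁅x⁆ , y∈Fx' = subst (λ z → _ ∈ F z) (x∈⁅y⁆⇒x≡y x x'∈⁅x⁆) y∈Fx'

module _ (F : SVMap n k) where

  img-mono : ∀ {V W} → V ⊆ W → img F V ⊆ img F W
  img-mono V⊆W y∈ = let (x , x∈V , y∈Fx) = ∈-img⁻ F y∈ in ∈-img⁺ F (V⊆W x∈V) y∈Fx

  img-∪ : ∀ U W → img F (U ∪ W) ≡ img F U ∪ img F W
  img-∪ U W = ⊆-antisym ⊆∪ ∪⊆
    where
    ⊆∪ : img F (U ∪ W) ⊆ img F U ∪ img F W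
    ⊆∪ y∈ with ∈-img⁻ F y∈
    ... | x , x∈ , y∈Fx = x∈p∪q⁺
      ([ (λ x∈U → inj₁ (∈-img⁺ F x∈U y∈Fx)) , (λ x∈W → inj₂ (∈-img⁺ F x∈W y∈Fx)) ]′ (x∈p∪q⁻ U W x∈))
    ∪⊆ : img F U ∪ img F W ⊆ img F (U ∪ W)
    ∪⊆ y∈ = [ img-mono (p⊆p∪q W) , img-mono (q⊆p∪q U W) ]′ (x∈p∪q⁻ _ _ y∈)

  img-compl : ∀ Z W → img (compl F Z) W ≡ img F W ─ Z
  img-compl Z W = ⊆-antisym
    (λ y∈ → let (x , x∈W , y∈) = ∈-img⁻ (compl F Z) y∈ in
      x∈p∧x∉q⇒x∈p─q (∈-img⁺ F x∈W (p─q⊆p (F x) Z y∈)) (x∈p─q⇒x∉q y∈))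
    (λ y∈ → let (x , x∈W , y∈Fx) = ∈-img⁻ F (p─q⊆p _ Z y∈) in
      ∈-img⁺ (compl F Z) x∈W (x∈p∧x∉q⇒x∈p─q y∈Fx (x∈p─q⇒x∉q y∈)))

  ∣img-∪∣ : ∀ U W → ∣ img F (U ∪ W) ∣ ≡ ∣ img F U ∣ + ∣ img (complW F U) W ∣
  ∣img-∪∣ U W = begin
    ∣ img F (U ∪ W) ∣                      ≡⟨ cong ∣_∣ (img-∪ U W) ⟩
    ∣ img F U ∪ img F W ∣                  ≡⟨ ∣p∪q∣≡∣p∣+∣q─p∣ (img F U) (img F W) ⟩
    ∣ img F U ∣ + ∣ img F W ─ img F U ∣    ≡⟨ cong (λ r → ∣ img F U ∣ + ∣ r ∣) (img-compl (img F U) W) ⟨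
    ∣ img F U ∣ + ∣ img (complW F U) W ∣   ∎
    where open ≡-Reasoning

  ∣img⊥∣≡0 : ∣ img F ⊥ ∣ ≡ 0
  ∣img⊥∣≡0 = trans (cong ∣_∣ (Empty-unique λ (_ , y∈) → ∉⊥ (proj₁ (proj₂ (∈-img⁻ F y∈))))) (∣⊥∣≡0 k)

HallOn : SVMap n k → Subset n → Set
HallOn G D = ∀ W → W ⊆ D → ∣ W ∣ ≤ ∣ img G W ∣

HallOn⇒Nonempty : ∀ {G : SVMap n k} {D} → HallOn G D → x ∈ D → Nonempty (G x)
HallOn⇒Nonempty {x = x} {G} hall x∈D =
  let (y , y∈) = ∣p∣>0⇒Nonempty (subst (_≤ ∣ img G ⁅ x ⁆ ∣) (∣⁅x⁆∣≡1 x) (hall ⁅ x ⁆ (x∈p⇒⁅x⁆⊆p x∈D)))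
  in y , ∈-img⁅x⁆⁻ G y∈

critical? : (G : SVMap n k) (D W : Subset n) → Dec (Critical G D W)
critical? G D W = (W ⊆? D) ×-dec (nonempty? W ×-dec (∣ img G W ∣ ℕ.≟ ∣ W ∣))

module _ {F : SVMap n k} (hall : HallCondition F) {U : Subset n}
         (U-tight : ∣ img F U ∣ ≡ ∣ U ∣) where

  complW-hall : HallOn (complW F U) (∁ U)
  complW-hall W W⊆∁U = ℕ.+-cancelˡ-≤ ∣ U ∣ _ _ (begin
    ∣ U ∣ + ∣ W ∣                         ≡⟨ Disjoint⇒∣p∪q∣≡∣p∣+∣q∣ (q⊆∁p⇒Disjoint W⊆∁U) ⟨
    ∣ U ∪ W ∣                             ≤⟨ hall (U ∪ W) ⟩
    ∣ img F (U ∪ W) ∣                     ≡⟨ ∣img-∪∣ F U W ⟩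
    ∣ img F U ∣ + ∣ img (complW F U) W ∣  ≡⟨ cong (_+ ∣ img (complW F U) W ∣) U-tight ⟩
    ∣ U ∣ + ∣ img (complW F U) W ∣        ∎)
    where open ℕ.≤-Reasoning

  complW-Nonempty : x ∈ ∁ U → Nonempty (complW F U x)
  complW-Nonempty = HallOn⇒Nonempty complW-hall

  tight-∪ : ∀ {W} → W ⊆ ∁ U → ∣ img (complW F U) W ∣ ≡ ∣ W ∣ → ∣ img F (U ∪ W) ∣ ≡ ∣ U ∪ W ∣
  tight-∪ {W} W⊆∁U W-tight = begin
    ∣ img F (U ∪ W) ∣                     ≡⟨ ∣img-∪∣ F U W ⟩
    ∣ img F U ∣ + ∣ img (complW F U) W ∣  ≡⟨ cong₂ _+_ U-tight W-tight ⟩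
    ∣ U ∣ + ∣ W ∣                         ≡⟨ Disjoint⇒∣p∪q∣≡∣p∣+∣q∣ (q⊆∁p⇒Disjoint W⊆∁U) ⟨
    ∣ U ∪ W ∣                             ∎
    where open ≡-Reasoning

module _ {F : SVMap n k} where

  HallSteps⇒≢[] : ∀ {U Ws} → HallSteps F U Ws → Ws ≢ []
  HallSteps⇒≢[] {Ws = []} ()

  HallSteps⇒⊆∁ : ∀ {U} Ws → HallSteps F U Ws → All (_⊆ ∁ U) Ws
  HallSteps⇒⊆∁ (W ∷ [])      (_ , (W⊆ , _))          = W⊆ ∷ []
  HallSteps⇒⊆∁ (W ∷ V ∷ Ws) (_ , (W⊆ , _) , _ , hs) =
    W⊆ ∷ All.map r⊆∁p∪q⇒r⊆∁p (HallSteps⇒⊆∁ (V ∷ Ws) hs)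

  HallSteps⇒Nonempty : ∀ {U} Ws → HallSteps F U Ws → All Nonempty Ws
  HallSteps⇒Nonempty (W ∷ [])      (_ , (_ , ne , _))          = ne ∷ []
  HallSteps⇒Nonempty (W ∷ V ∷ Ws) (_ , (_ , ne , _) , _ , hs) = ne ∷ HallSteps⇒Nonempty (V ∷ Ws) hs

  HallSteps⇒Disjoint : ∀ {U} Ws → HallSteps F U Ws → AllPairs Disjoint Ws
  HallSteps⇒Disjoint (W ∷ [])      _                 = [] ∷ []
  HallSteps⇒Disjoint (W ∷ V ∷ Ws) (_ , _ , _ , hs) =
    All.map (q⊆∁p⇒Disjoint ∘′ r⊆∁p∪q⇒r⊆∁q) (HallSteps⇒⊆∁ (V ∷ Ws) hs)
    ∷ HallSteps⇒Disjoint (V ∷ Ws) hs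

module _ {F : SVMap n k} (hall : HallCondition F) where

  hallBlocks : ∀ U → Acc _⊃_ U → ∣ img F U ∣ ≡ ∣ U ∣ → Nonempty (∁ U) →
               ∃ λ Ws → HallSteps F U Ws × U ∪ ⋃ Ws ≡ ⊤
  hallBlocks U (acc rs) U-tight ∁U≢∅ with anySubset? (critical? (complW F U) (∁ U))
  ... | no ∄W = ∁ U ∷ [] ,
    (complW-Nonempty hall U-tight , ⊆-refl , ∁U≢∅ , λ W _ W-crit → ∄W (W , W-crit)) ,
    trans (cong (U ∪_) (∪-identityʳ (∁ U))) (p∪∁p≡⊤ U)
  ... | yes (W₀ , W₀-crit)
    with ⊂-minimal (critical? (complW F U) (∁ U)) (⊂-wellFounded W₀) W₀-crit
  ... | W , W-crit@(W⊆∁U , W≢∅ , W-tight) , W-min with nonempty? (∁ (U ∪ W))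
  ...   | no ∁U∪W≡∅ = W ∷ [] ,
    (complW-Nonempty hall U-tight ∘′ W⊆∁U , W⊆∁U , W≢∅ , W-min) ,
    trans (cong (U ∪_) (∪-identityʳ W)) (Empty∁⇒≡⊤ ∁U∪W≡∅)
  ...   | yes ∁U∪W≢∅
    with hallBlocks (U ∪ W) (rs (p⊂p∪q W⊆∁U W≢∅)) (tight-∪ hall U-tight W⊆∁U W-tight) ∁U∪W≢∅
  ...     | [] , () , _
  ...     | V ∷ Vs , steps , covers = W ∷ V ∷ Vs ,
    (complW-Nonempty hall U-tight ∘′ W⊆∁U , (W⊆∁U , W≢∅ , W-min) , W-crit , steps) ,
    trans (sym (∪-assoc U W (⋃ (V ∷ Vs)))) covers

theorem3p1 : (n k : ℕ) → 0 < n → 0 < k → (F : SVMap n k) →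
    HallCondition F → Σ (List (Subset n)) (λ Ws → HallPartition F Ws)
theorem3p1 (suc n) k _ _ F hall
  with hallBlocks hall ⊥ (⊃-wellFounded ⊥) (trans (∣img⊥∣≡0 F) (sym (∣⊥∣≡0 (suc n))))
                  (Fin.zero , x∉p⇒x∈∁p ∉⊥)
... | Ws , steps , covers = Ws ,
  HallSteps⇒≢[] steps ,
  HallSteps⇒Nonempty Ws steps ,
  HallSteps⇒Disjoint Ws steps ,
  trans (sym (∪-identityˡ (⋃ Ws))) covers ,
  steps
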